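{- Let $G$ be a finite simple graph such that $P_M(H)$ has the integer decomposition property for every proper subgraph $H$ of $G$. If for every positive integer $t$ every nondegenerate $t$-matching on $G$ splits, then $P_M(G)$ has the integer decomposition property.
   Context: For a graph $G$ with edge set $E$, $P_M(G)\subset\mathbb{R}^E$ is the convex hull of the indicator vectors of all matchings of $G$. For $t\in\mathbb{Z}_{\ge0}$, a $t$-matching on $G$ is a lattice point of $tP_M(G)$. A $t$-matching $x$ is nondegenerate if $x(e)>0$ for every edge $e$. A $t$-matching $x$ ($t\ge1$) splits if $x=m+y$ for some matching $m$ (as indicator vector) and some $(t-1)$-matching $y$ on $G$. A lattice polytope $P\subset\mathbb{R}^d$ has the integer decomposition property if for every $t\in\mathbb{Z}_{>0}$ and $\alpha\in tP\cap\mathbb{Z}^d$ there exist $\alpha_1,\dots,\alpha_t\in P\cap\mathbb{Z}^d$ with $\alpha=\sum\alpha_i$. -}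

module Defs where

open import Data.Nat using (ℕ; zero; suc; _+_; _*_; _<_)
open import Data.Bool using (Bool; true; false; if_then_else_)
open import Data.Fin using (Fin)
open import Data.Fin.Base using () renaming (toℕ to toℕ)
open import Data.List using (List; length; map; allFin)
open import Data.Nat.ListAction using (sum)
open import Data.List.Relation.Unary.All using (All)
open import Data.Product using (_×_; _,_; proj₁; proj₂; Σ; ∃; ∃-syntax)
open import Data.Sum using (_⊎_)
open import Relation.Binary.PropositionalEquality using (_≡_; _≢_)

record Graph : Set where
  field
    n : ℕ
    m : ℕ
    end₁ : Fin m → Fin n
    end₂ : Fin m → Fin n
    loopless : ∀ e → end₁ e ≢ end₂ e
    noParallel : ∀ e f →
      ((end₁ e ≡ end₁ f × end₂ e ≡ end₂ f) ⊎ (end₁ e ≡ end₂ f × end₂ e ≡ end₁ f)) →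
      e ≡ f

open Graph public

EdgeSet : Graph → Set
EdgeSet G = Fin (m G) → Bool

VertexSet : Graph → Set
VertexSet G = Fin (n G) → Bool

allEdges : (G : Graph) → EdgeSet G
allEdges G e = true

-- vectors in ℤ^E with nonnegative entries (all lattice points of t·P_M are ≥ 0)
EVec : Graph → Set
EVec G = Fin (m G) → ℕ

Adjacent : (G : Graph) → Fin (m G) → Fin (m G) → Set
Adjacent G e f = end₁ G e ≡ end₁ G f ⊎ end₁ G e ≡ end₂ G f
               ⊎ end₂ G e ≡ end₁ G f ⊎ end₂ G e ≡ end₂ G f

IsMatching : (G : Graph) → EdgeSet G → (Fin (m G) → Bool) → Set
IsMatching G S M =
  (∀ e → M e ≡ true → S e ≡ true) ×
  (∀ e f → M e ≡ true → M f ≡ true → e ≢ f → Adjacent G e f → Data.Empty.⊥)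
  where import Data.Empty

ind : (G : Graph) → (Fin (m G) → Bool) → EVec G
ind G M e = if M e then 1 else 0

-- x ∈ t·P_M(G,S) ∩ ℤ^E: x/t is a (rational) convex combination of matchings,
-- i.e. for some N > 0, N·x is a sum of exactly N·t matching indicator vectors
-- (repetitions allowed).
TMatching : (G : Graph) → EdgeSet G → ℕ → EVec G → Set
TMatching G S t x =
  Σ ℕ λ N → 0 < N × Σ (List (Fin (m G) → Bool)) λ L →
    All (IsMatching G S) L × length L ≡ N * t ×
    (∀ e → N * x e ≡ sum (map (λ M → ind G M e) L))

-- integer decomposition property of P_M(G,S) ⊂ ℝ^S
-- (lattice points supported on S are identified with ℤ^S)
IDP : (G : Graph) → EdgeSet G → Set
IDP G S = ∀ t → 0 < t → ∀ x → TMatching G S t x →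
  Σ (Fin t → EVec G) λ α →
    (∀ i → TMatching G S 1 (α i)) ×
    (∀ e → x e ≡ sum (map (λ i → α i e) (allFin t)))

Nondegenerate : (G : Graph) → EVec G → Set
Nondegenerate G x = ∀ e → 0 < x e

Splits : (G : Graph) → ℕ → EVec G → Set
Splits G zero x = Data.Empty.⊥ where import Data.Empty
Splits G (suc t) x = Σ (Fin (m G) → Bool) λ M → Σ (EVec G) λ y →
  IsMatching G (allEdges G) M × TMatching G (allEdges G) t y ×
  (∀ e → x e ≡ ind G M e + y e)

IsSubgraph : (G : Graph) → VertexSet G → EdgeSet G → Set
IsSubgraph G vs es = ∀ e → es e ≡ true → vs (end₁ G e) ≡ true × vs (end₂ G e) ≡ true

Proper : (G : Graph) → VertexSet G → EdgeSet G → Set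
Proper G vs es = (∃[ v ] vs v ≡ false) ⊎ (∃[ e ] es e ≡ false)

{-# OPTIONS --safe #-}
module Submission where

-- A t-matching x that vanishes on some edge e is a combination of
-- matchings avoiding e, hence a t-matching of the proper subgraph G ∖ e, whose
-- matching polytope has the integer decomposition property by hypothesis.  Otherwise
-- x is nondegenerate, so it splits off a matching and leaves a (t - 1)-matching.

open import Defs
open import Data.Bool using (true; false; not; _∧_)
open import Data.Fin using (Fin; zero; suc; _≟_)
open import Data.Fin.Properties using (any?)
open import Data.List using (List; []; _∷_; map; tabulate; allFin)
open import Data.List.Properties using (map-tabulate)
open import Data.List.Relation.Unary.All as All using (All; []; _∷_)
open import Data.List.Relation.Unary.All.Properties using (map⁻)
open import Data.Nat using (ℕ; zero; suc; _+_; _*_; _<_; z≤n; s≤s) renaming (_≟_ to _≟ℕ_)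
open import Data.Nat.ListAction using (sum)
open import Data.Nat.Properties using (*-zeroʳ; m+n≡0⇒m≡0; m+n≡0⇒n≡0; n≢0⇒n>0)
open import Data.Product using (_×_; _,_; Σ)
open import Data.Sum using (inj₂)
open import Relation.Nullary using (does; yes; no; contradiction)
open import Relation.Nullary.Decidable using (dec-true)
open import Relation.Binary.PropositionalEquality using (_≡_; refl; sym; trans; cong)
open Relation.Binary.PropositionalEquality.≡-Reasoning

sum≡0⇒All≡0 : ∀ (ns : List ℕ) → sum ns ≡ 0 → All (_≡ 0) ns
sum≡0⇒All≡0 []       _   = []
sum≡0⇒All≡0 (n ∷ ns) eq0 = m+n≡0⇒m≡0 n eq0 ∷ sum≡0⇒All≡0 ns (m+n≡0⇒n≡0 n eq0)

sum-allFin-suc : ∀ t (g : Fin (suc t) → ℕ) →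
  sum (map g (allFin (suc t))) ≡ g zero + sum (map (λ i → g (suc i)) (allFin t))
sum-allFin-suc t g = cong (λ ns → g zero + sum ns) (begin
  map g (tabulate suc)               ≡⟨ map-tabulate suc g ⟩
  tabulate (λ i → g (suc i))         ≡⟨ map-tabulate (λ i → i) (λ i → g (suc i)) ⟨
  map (λ i → g (suc i)) (allFin t)   ∎)

module _ (G : Graph) where

  _⊆_ : EdgeSet G → EdgeSet G → Set
  S ⊆ S′ = ∀ e → S e ≡ true → S′ e ≡ true

  _∖_ : EdgeSet G → Fin (m G) → EdgeSet G
  (S ∖ e) f = not (does (f ≟ e)) ∧ S f

  ∖-removes : ∀ S e → (S ∖ e) e ≡ false
  ∖-removes S e rewrite dec-true (e ≟ e) refl = refl

  Decomposition : EdgeSet G → (t : ℕ) → EVec G → Set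
  Decomposition S t x = Σ (Fin t → EVec G) λ α →
    (∀ i → TMatching G S 1 (α i)) × (∀ e → x e ≡ sum (map (λ i → α i e) (allFin t)))

  IsMatching-mono : ∀ {S S′ M} → S ⊆ S′ → IsMatching G S M → IsMatching G S′ M
  IsMatching-mono S⊆S′ (inS , disjoint) = (λ e Me → S⊆S′ e (inS e Me)) , disjoint

  TMatching-mono : ∀ {S S′ t x} → S ⊆ S′ → TMatching G S t x → TMatching G S′ t x
  TMatching-mono S⊆S′ (N , N>0 , L , matchings , len , avg) =
    N , N>0 , L , All.map (IsMatching-mono S⊆S′) matchings , len , avg

  Decomposition-mono : ∀ {S S′ t x} → S ⊆ S′ → Decomposition S t x → Decomposition S′ t x
  Decomposition-mono S⊆S′ (α , αᵢ-matching , x≡Σα) =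
    α , (λ i → TMatching-mono S⊆S′ (αᵢ-matching i)) , x≡Σα

  IsMatching-∖ : ∀ {S M} e → M e ≡ false → IsMatching G S M → IsMatching G (S ∖ e) M
  IsMatching-∖ {S} {M} e Me≡false (inS , disjoint) = inS∖e , disjoint
    where
    inS∖e : ∀ f → M f ≡ true → (S ∖ e) f ≡ true
    inS∖e f Mf with f ≟ e
    ... | yes refl = contradiction (trans (sym Mf) Me≡false) λ ()
    ... | no _     = inS f Mf

  ind≡0⇒false : ∀ M e → ind G M e ≡ 0 → M e ≡ false
  ind≡0⇒false M e with M e
  ... | true  = λ ()
  ... | false = λ _ → refl

  TMatching-∖ : ∀ {S t x} e → x e ≡ 0 → TMatching G S t x → TMatching G (S ∖ e) t x
  TMatching-∖ e xe≡0 (N , N>0 , L , matchings , len , avg) =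
    N , N>0 , L , avoid L matchings (map⁻ (sum≡0⇒All≡0 _ Σind≡0)) , len , avg
    where
    Σind≡0 : sum (map (λ M → ind G M e) L) ≡ 0
    Σind≡0 = trans (sym (avg e)) (trans (cong (N *_) xe≡0) (*-zeroʳ N))
    avoid : ∀ Ms → All (IsMatching G _) Ms → All (λ M → ind G M e ≡ 0) Ms →
            All (IsMatching G (_ ∖ e)) Ms
    avoid []       []       []       = []
    avoid (M ∷ Ms) (m ∷ ms) (z ∷ zs) = IsMatching-∖ e (ind≡0⇒false M e z) m ∷ avoid Ms ms zs

  TMatching-0⇒≡0 : ∀ {S x} → TMatching G S 0 x → ∀ e → x e ≡ 0
  TMatching-0⇒≡0 {x = x} (suc k , _ , [] , _ , _ , avg) e = m+n≡0⇒m≡0 (x e) (avg e)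
  TMatching-0⇒≡0 (suc k , _ , _ ∷ _ , _ , len , _) e with trans len (*-zeroʳ (suc k))
  ... | ()

  matching⇒TMatching-1 : ∀ {S M} → IsMatching G S M → TMatching G S 1 (ind G M)
  matching⇒TMatching-1 {M = M} isM = 1 , s≤s z≤n , M ∷ [] , isM ∷ [] , refl , λ _ → refl

  Decomposition-0 : ∀ {S x} → TMatching G S 0 x → Decomposition S 0 x
  Decomposition-0 tm = (λ ()) , (λ ()) , TMatching-0⇒≡0 tm

  Decomposition-cons : ∀ {S t x a y} → TMatching G S 1 a → Decomposition S t y →
    (∀ e → x e ≡ a e + y e) → Decomposition S (suc t) x
  Decomposition-cons {S} {t} {x} {a} tmₐ (β , βᵢ-matching , y≡Σβ) x≡a+y =
    α , αᵢ-matching , x≡Σα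
    where
    α : Fin (suc t) → EVec G
    α zero    = a
    α (suc i) = β i
    αᵢ-matching : ∀ i → TMatching G S 1 (α i)
    αᵢ-matching zero    = tmₐ
    αᵢ-matching (suc i) = βᵢ-matching i
    x≡Σα : ∀ e → x e ≡ sum (map (λ i → α i e) (allFin (suc t)))
    x≡Σα e = begin
      x e                                          ≡⟨ x≡a+y e ⟩
      a e + _                                      ≡⟨ cong (a e +_) (y≡Σβ e) ⟩
      a e + sum (map (λ i → β i e) (allFin t))     ≡⟨ sum-allFin-suc t (λ i → α i e) ⟨
      sum (map (λ i → α i e) (allFin (suc t)))     ∎

corollary3p11 : (G : Graph) →
    (∀ (vs : VertexSet G) (es : EdgeSet G) → IsSubgraph G vs es → Proper G vs es → IDP G es) →
    (∀ (t : ℕ) → 0 < t → ∀ (x : EVec G) → TMatching G (allEdges G) t x → Nondegenerate G x → Splits G t x) →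
    IDP G (allEdges G)
corollary3p11 G idp-proper split t _ = decompose t
  where
  decompose : ∀ t x → TMatching G (allEdges G) t x → Decomposition G (allEdges G) t x
  decompose zero    x tm = Decomposition-0 G tm
  decompose (suc t) x tm with any? (λ e → x e ≟ℕ 0)
  ... | yes (e , xe≡0) =
    Decomposition-mono G (λ _ _ → refl)
      (idp-proper (λ _ → true) (_∖_ G (allEdges G) e) (λ _ _ → refl , refl)
        (inj₂ (e , ∖-removes G (allEdges G) e)) (suc t) (s≤s z≤n) x (TMatching-∖ G e xe≡0 tm))
  ... | no no-zero
    with split (suc t) (s≤s z≤n) x tm (λ e → n≢0⇒n>0 λ xe≡0 → no-zero (e , xe≡0))
  ... | M , y , isM , tmᵧ , x≡M+y =
    Decomposition-cons G (matching⇒TMatching-1 G isM) (decompose t y tmᵧ) x≡M+y
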